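{- For every process \(P\): (1) for every identifier pattern \(\mathit{ip}\), the identified process obtained by splitting \(\mathit{ip}\) along the parallel structure of \(P\) (the splitter helper \(\cap^?(\mathit{ip},P)\), recomposed) is well-identified; (2) for every seed \(\mathsf{s}\) and \(j\in\{1,2\}\), if \(\mathsf{s}\circ P\) is well-identified then \([\cap_j](\mathsf{s})\circ P\) is well-identified.
   Context: Fix an identifier structure: identifiers \(\mathcal{I}=\mathcal{I}_a\sqcup\mathcal{I}_p\), a bijection \(\gamma:\mathbb{N}\to\mathcal{I}_a\), a bijection \(\oplus:\mathcal{I}_a\times\mathcal{I}_a\to\mathcal{I}_p\). An identifier pattern is \((c,s)\) with \(s>0\), generating the stream \(\gamma(c),\gamma(c+s),\gamma(c+2s),\dots\); two patterns are compatible if their streams are disjoint. A splitter \(\cap\) maps a pattern to a pair of compatible patterns, with projections \(\cap_1,\cap_2\). A seed is a pattern or a pair of seeds with pairwise compatible patterns; \([\cap_j]\) is defined by \([\cap_j](\mathit{ip})=\cap_j(\mathit{ip})\) and \([\cap_j](\mathsf{s}_1,\mathsf{s}_2)=([\cap_j](\mathsf{s}_1),[\cap_j](\mathsf{s}_2))\). Processes are CCS processes with prefix, parallel composition, restriction, non-deterministic choice \(P\veebar Q\), guarded sum and internal choice \(P\sqcap Q\). The splitter helper is \(\cap^?(\mathit{ip},P_1\mid P_2)=(\cap^?(\cap_1(\mathit{ip}),P_1),\cap^?(\cap_2(\mathit{ip}),P_2))\) and \(\cap^?(\mathit{ip},P)=\mathit{ip}\circ P\) otherwise. An identified process \(\mathsf{s}\circ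 P\) is well-identified if \(\mathsf{s}=(\mathsf{s}_1,\mathsf{s}_2)\), \(P=P_1\mid P_2\) and both \(\mathsf{s}_j\circ P_j\) are well-identified, or \(P\) is not a parallel composition and \(\mathsf{s}\) is a single pattern. -}

module Defs where

open import Data.Nat using (ℕ; _+_; _*_; _<_)
open import Data.Product using (_×_; _,_; proj₁; proj₂)
open import Data.List using (List)
open import Data.Fin using (Fin; zero; suc)
open import Relation.Binary.PropositionalEquality using (_≡_)
open import Relation.Nullary using (¬_)
open import Data.Empty using (⊥)
open import Data.Unit using (⊤)
open import Function.Bundles using (_⤖_; Bijection)

record IdStructure : Set₁ where
  field
    Ia   : Set
    Ip   : Set
    γ    : ℕ ⤖ Ia
    ⊕    : (Ia × Ia) ⤖ Ip

module _ (IS : IdStructure) where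
  open IdStructure IS

  γf : ℕ → Ia
  γf = Bijection.to γ

  record Pattern : Set where
    constructor ⟨_,_⟩[_]
    field
      c   : ℕ
      s   : ℕ
      s>0 : 0 < s

  stream : Pattern → ℕ → Ia
  stream ip k = γf (Pattern.c ip + k * Pattern.s ip)

  Compatible : Pattern → Pattern → Set
  Compatible ip₁ ip₂ = ∀ m n → ¬ (stream ip₁ m ≡ stream ip₂ n)

  record Splitter : Set where
    field
      split  : Pattern → Pattern × Pattern
      compat : ∀ ip → Compatible (proj₁ (split ip)) (proj₂ (split ip))

  -- seeds: trees of patterns; the pairwise compatibility requirement is IsSeed
  data Seed : Set where
    pat  : Pattern → Seed
    pair : Seed → Seed → Seed

  data _∈ₛ_ : Pattern → Seed → Set where
    here  : ∀ {ip} → ip ∈ₛ pat ip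
    left  : ∀ {ip s₁ s₂} → ip ∈ₛ s₁ → ip ∈ₛ pair s₁ s₂
    right : ∀ {ip s₁ s₂} → ip ∈ₛ s₂ → ip ∈ₛ pair s₁ s₂

  data IsSeed : Seed → Set where
    pat  : ∀ ip → IsSeed (pat ip)
    pair : ∀ {s₁ s₂} → IsSeed s₁ → IsSeed s₂ →
           (∀ {ip₁ ip₂} → ip₁ ∈ₛ s₁ → ip₂ ∈ₛ s₂ → Compatible ip₁ ip₂) →
           IsSeed (pair s₁ s₂)

  module _ (sp : Splitter) where
    open Splitter sp

    ∩ : Fin 2 → Pattern → Pattern
    ∩ zero    ip = proj₁ (split ip)
    ∩ (suc _) ip = proj₂ (split ip)

    lift∩ : Fin 2 → Seed → Seed
    lift∩ j (pat ip)     = pat (∩ j ip)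
    lift∩ j (pair s₁ s₂) = pair (lift∩ j s₁) (lift∩ j s₂)

data Action : Set where
  inp  : ℕ → Action
  out  : ℕ → Action
  τ    : Action

data Proc : Set where
  _·_  : Action → Proc → Proc
  _∣_  : Proc → Proc → Proc
  ν    : ℕ → Proc → Proc
  _⊻_  : Proc → Proc → Proc
  gsum : List (Action × Proc) → Proc     -- guarded sum Σ αᵢ.Pᵢ (empty = 0)
  _⊓_  : Proc → Proc → Proc

module _ (IS : IdStructure) where

  record IdProc : Set where
    constructor _∘_
    field
      seed : Seed IS
      proc : Proc

  module _ (sp : Splitter IS) where
    split? : Pattern IS → Proc → Seed IS
    split? ip (P₁ ∣ P₂) = pair (split? (∩ IS sp zero ip) P₁) (split? (∩ IS sp (suc zero) ip) P₂)
    split? ip (α · P)   = pat ip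
    split? ip (ν a P)   = pat ip
    split? ip (P ⊻ Q)   = pat ip
    split? ip (gsum xs) = pat ip
    split? ip (P ⊓ Q)   = pat ip

    ∩? : Pattern IS → Proc → IdProc
    ∩? ip P = split? ip P ∘ P

  NotPar : Proc → Set
  NotPar (_ ∣ _) = ⊥
  NotPar _       = ⊤

  data WellIdentified : IdProc → Set where
    wi-par : ∀ {s₁ s₂ P₁ P₂} → WellIdentified (s₁ ∘ P₁) → WellIdentified (s₂ ∘ P₂) →
             WellIdentified (pair s₁ s₂ ∘ (P₁ ∣ P₂))
    wi-pat : ∀ {ip P} → NotPar P → WellIdentified (pat ip ∘ P)

module Submission where

open import Defs
open import Data.Fin using (Fin)
open import Data.Product using (_×_; _,_)
open import Data.Unit using (tt)

module _ (IS : IdStructure) (sp : Splitter IS) where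

  ∩?-wellIdentified : ∀ P (ip : Pattern IS) → WellIdentified IS (∩? IS sp ip P)
  ∩?-wellIdentified (_ · _)   ip = wi-pat tt
  ∩?-wellIdentified (P₁ ∣ P₂) ip = wi-par (∩?-wellIdentified P₁ _) (∩?-wellIdentified P₂ _)
  ∩?-wellIdentified (ν _ _)   ip = wi-pat tt
  ∩?-wellIdentified (_ ⊻ _)   ip = wi-pat tt
  ∩?-wellIdentified (gsum _)  ip = wi-pat tt
  ∩?-wellIdentified (_ ⊓ _)   ip = wi-pat tt

  -- [∩ⱼ] preserves the tree shape of a seed, which is all that well-identification inspects;
  -- in particular no compatibility of the seed's patterns is needed.
  lift∩-wellIdentified : ∀ j {s P} → WellIdentified IS (s ∘ P) →
                         WellIdentified IS (lift∩ IS sp j s ∘ P)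
  lift∩-wellIdentified j (wi-par w₁ w₂) = wi-par (lift∩-wellIdentified j w₁) (lift∩-wellIdentified j w₂)
  lift∩-wellIdentified j (wi-pat notPar) = wi-pat notPar

lemma7 : (IS : IdStructure) (sp : Splitter IS) (P : Proc) →
    ((ip : Pattern IS) → WellIdentified IS (∩? IS sp ip P))
    × ((s : Seed IS) (j : Fin 2) → IsSeed IS s →
       WellIdentified IS (s ∘ P) → WellIdentified IS (lift∩ IS sp j s ∘ P))
lemma7 IS sp P = ∩?-wellIdentified IS sp P , λ _ j _ → lift∩-wellIdentified IS sp j
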